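{- Let $t > 0$ be an integer, let $b$ be an odd integer, and let $q_d(n) = 2^t n^2 + bn$ for $n \geq 0$. Let $k \geq 0$ be an integer. Then for every positive integer $m < 2^{k+1}$ there exist integers $i, j$ with $0 \leq i < j \leq 2^k$ such that $m \mid q_d(j) - q_d(i)$. -}

module Defs where

open import Data.Nat using (ℕ)
open import Data.Integer using (ℤ; +_; _+_; _*_; _^_)

qd : ℕ → ℤ → ℕ → ℤ
qd t b n = ((+ 2) ^ t) * ((+ n) * (+ n)) + b * (+ n)

open import Data.Product using (∃)
open import Relation.Binary.PropositionalEquality using (_≡_)

OddInt : ℤ → Set
OddInt b = ∃ λ c → b ≡ (+ 2) * c + (+ 1)

{-# OPTIONS --safe #-}
-- For odd m = 1 + 2h the number 2 is invertible modulo m (its inverse is h + 1), so the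
-- congruence 2^t e + b ≡ 0 has a solution 1 ≤ e ≤ m.  Writing e = i + j with j − i ∈ {1, 2},
-- the factorisation q(j) − q(i) = (j − i)(2^t (i + j) + b) gives the collision, and
-- j ≤ h + 1 ≤ 2^k.  For even m the identity q_t(2n) = 2 q_{t+1}(n) reduces the problem to
-- the modulus m/2, the exponent t + 1 and the range 2^(k−1).
module Submission where

open import Defs
open import Data.Nat using (ℕ; _<_; _≤_; _^_; _+_)
open import Data.Integer using (ℤ; +_; _-_)
open import Data.Integer.Divisibility using (_∣_)
open import Data.Product using (Σ; _×_)

open import Data.Nat using (zero; suc; _*_; s≤s; s≤s⁻¹; z≤n; NonZero)
open import Data.Nat.Properties
  using (+-comm; +-suc; *-suc; n<1+n; n≤1+n; ≤-trans; <-trans; *-cancelˡ-<; *-cancelˡ-≤; *-monoʳ-≤; *-monoʳ-<)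
open import Data.Nat.Tactic.RingSolver using () renaming (solve-∀ to ℕ-solve-∀)
import Data.Integer as ℤ
open import Data.Integer.Properties using (pos-*; *-zeroˡ)
open import Data.Integer.DivMod using (_%ℕ_; _/ℕ_; a≡a%ℕn+[a/ℕn]*n; n%ℕd<d)
open import Data.Integer.Divisibility.Signed
  using (divides; ∣-reflexive; ∣m∣n⇒∣m+n; ∣m∣n⇒∣m-n; ∣n⇒∣m*n; *-monoʳ-∣; ∣⇒∣ᵤ)
  renaming (_∣_ to _∣ₛ_)
open import Data.Integer.Tactic.RingSolver using (solve-∀)
open import Data.Product using (_,_)
open import Relation.Binary.PropositionalEquality using (_≡_; sym; trans; cong; cong₂; subst; subst₂; module ≡-Reasoning)
open ≡-Reasoning

data Parity : ℕ → Set where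
  even : ∀ h → Parity (2 * h)
  odd  : ∀ h → Parity (1 + 2 * h)

parity : ∀ n → Parity n
parity zero = even 0
parity (suc n) with parity n
... | even h = odd h
... | odd h  = subst Parity (*-suc 2 h) (even (suc h))

midpoint-split : ∀ {h r} → r ≤ 2 * h → Σ ℕ λ i → Σ ℕ λ j → i < j × j ≤ suc h × i + j ≡ suc r
midpoint-split {h} {r} r≤2h with parity r
... | even s = s , 1 + s , n<1+n s , s≤s (*-cancelˡ-≤ 2 r≤2h) , sum s
  where
  sum : ∀ s → s + (1 + s) ≡ 1 + 2 * s
  sum = ℕ-solve-∀
... | odd s = s , 2 + s , s≤s (n≤1+n s) , s≤s (*-cancelˡ-< 2 s h r≤2h) , sum s
  where
  sum : ∀ s → s + (2 + s) ≡ 1 + (1 + 2 * s)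
  sum = ℕ-solve-∀

qd-difference : ∀ t b i j → qd t b j - qd t b i ≡ (+ j - + i) ℤ.* ((+ 2) ℤ.^ t ℤ.* (+ i ℤ.+ + j) ℤ.+ b)
qd-difference t b i j = factorisation ((+ 2) ℤ.^ t) b (+ i) (+ j)
  where
  factorisation : ∀ a b x y →
    (a ℤ.* (y ℤ.* y) ℤ.+ b ℤ.* y) - (a ℤ.* (x ℤ.* x) ℤ.+ b ℤ.* x) ≡ (y - x) ℤ.* (a ℤ.* (x ℤ.+ y) ℤ.+ b)
  factorisation = solve-∀

qd-double-difference : ∀ t b i j →
  qd t b (2 * j) - qd t b (2 * i) ≡ + 2 ℤ.* (qd (suc t) b j - qd (suc t) b i)
qd-double-difference t b i j = begin
  qd t b (2 * j) - qd t b (2 * i)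
    ≡⟨ cong₂ _-_ (qd-double j) (qd-double i) ⟩
  + 2 ℤ.* qd (suc t) b j - + 2 ℤ.* qd (suc t) b i
    ≡⟨ distrib (qd (suc t) b j) (qd (suc t) b i) ⟩
  + 2 ℤ.* (qd (suc t) b j - qd (suc t) b i) ∎
  where
  doubling : ∀ a b x → a ℤ.* ((+ 2 ℤ.* x) ℤ.* (+ 2 ℤ.* x)) ℤ.+ b ℤ.* (+ 2 ℤ.* x)
                     ≡ + 2 ℤ.* ((+ 2 ℤ.* a) ℤ.* (x ℤ.* x) ℤ.+ b ℤ.* x)
  doubling = solve-∀
  qd-double : ∀ n → qd t b (2 * n) ≡ + 2 ℤ.* qd (suc t) b n
  qd-double n = trans (cong (λ x → (+ 2) ℤ.^ t ℤ.* (x ℤ.* x) ℤ.+ b ℤ.* x) (pos-* 2 n))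
                      (doubling ((+ 2) ℤ.^ t) b (+ n))
  distrib : ∀ x y → + 2 ℤ.* x - + 2 ℤ.* y ≡ + 2 ℤ.* (x - y)
  distrib = solve-∀

∣x*y-1⇒∣x^t*y^t-1 : ∀ {m x y} t → m ∣ₛ x ℤ.* y - ℤ.1ℤ → m ∣ₛ x ℤ.^ t ℤ.* y ℤ.^ t - ℤ.1ℤ
∣x*y-1⇒∣x^t*y^t-1 {m} zero    _     = divides ℤ.0ℤ (sym (*-zeroˡ m))
∣x*y-1⇒∣x^t*y^t-1 {m} {x} {y} (suc t) m∣xy-1 =
  subst (m ∣ₛ_) (regroup x y (x ℤ.^ t) (y ℤ.^ t))
        (∣m∣n⇒∣m+n (∣n⇒∣m*n (x ℤ.* y) (∣x*y-1⇒∣x^t*y^t-1 t m∣xy-1)) m∣xy-1)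
  where
  regroup : ∀ x y u v → x ℤ.* y ℤ.* (u ℤ.* v - ℤ.1ℤ) ℤ.+ (x ℤ.* y - ℤ.1ℤ) ≡ x ℤ.* u ℤ.* (y ℤ.* v) - ℤ.1ℤ
  regroup = solve-∀

∣a*x+b∧∣x-y⇒∣a*y+b : ∀ {m a b x y} → m ∣ₛ a ℤ.* x ℤ.+ b → m ∣ₛ x - y → m ∣ₛ a ℤ.* y ℤ.+ b
∣a*x+b∧∣x-y⇒∣a*y+b {m} {a} {b} {x} {y} m∣ax+b m∣x-y =
  subst (m ∣ₛ_) (shift a b x y) (∣m∣n⇒∣m-n m∣ax+b (∣n⇒∣m*n a m∣x-y))
  where
  shift : ∀ a b x y → (a ℤ.* x ℤ.+ b) - a ℤ.* (x - y) ≡ a ℤ.* y ℤ.+ b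
  shift = solve-∀

-- A representative in [1, m] rather than [0, m): the root e = i + j with i < j must be positive.
positive-residue : ∀ m .{{_ : NonZero m}} (x : ℤ) → Σ ℕ λ r → r < m × + m ∣ₛ x - + suc r
positive-residue m x = r , n%ℕd<d (x - ℤ.1ℤ) m , divides q (begin
  x - + suc r                 ≡⟨ shift x (+ r) ⟩
  (x - ℤ.1ℤ) - + r            ≡⟨ cong (_- + r) (a≡a%ℕn+[a/ℕn]*n (x - ℤ.1ℤ) m) ⟩
  (+ r ℤ.+ q ℤ.* + m) - + r   ≡⟨ cancel (+ r) (q ℤ.* + m) ⟩
  q ℤ.* + m                   ∎)
  where
  r = (x - ℤ.1ℤ) %ℕ m
  q = (x - ℤ.1ℤ) /ℕ m
  shift : ∀ x r → x - (ℤ.1ℤ ℤ.+ r) ≡ (x - ℤ.1ℤ) - r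
  shift = solve-∀
  cancel : ∀ r z → (r ℤ.+ z) - r ≡ z
  cancel = solve-∀

odd-modulus-root : ∀ t b h → Σ ℕ λ r → r < 1 + 2 * h × + (1 + 2 * h) ∣ₛ (+ 2) ℤ.^ t ℤ.* + suc r ℤ.+ b
odd-modulus-root t b h =
  let r , r<m , m∣x-1-r = positive-residue (1 + 2 * h) x
  in r , r<m , ∣a*x+b∧∣x-y⇒∣a*y+b {a = (+ 2) ℤ.^ t} {x = x} root m∣x-1-r
  where
  x : ℤ
  x = ℤ.- b ℤ.* (+ suc h) ℤ.^ t
  two-inverse : + (1 + 2 * h) ∣ₛ (+ 2) ℤ.* + suc h - ℤ.1ℤ
  two-inverse = ∣-reflexive (cong +_ (sym (+-suc h (1 * h))))
  root : + (1 + 2 * h) ∣ₛ (+ 2) ℤ.^ t ℤ.* x ℤ.+ b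
  root = subst (_ ∣ₛ_) (factor ((+ 2) ℤ.^ t) ((+ suc h) ℤ.^ t) b)
               (∣n⇒∣m*n (ℤ.- b) (∣x*y-1⇒∣x^t*y^t-1 t two-inverse))
    where
    factor : ∀ p c b → ℤ.- b ℤ.* (p ℤ.* c - ℤ.1ℤ) ≡ p ℤ.* (ℤ.- b ℤ.* c) ℤ.+ b
    factor = solve-∀

Collision : ℕ → ℤ → ℕ → ℕ → Set
Collision t b k m = Σ ℕ λ i → Σ ℕ λ j → i < j × j ≤ 2 ^ k × + m ∣ₛ qd t b j - qd t b i

odd-collision : ∀ t b k h → 1 + 2 * h < 2 ^ suc k → Collision t b k (1 + 2 * h)
odd-collision t b k h m<2^[1+k] =
  let r , r<1+2h , m∣root = odd-modulus-root t b h
      i , j , i<j , j≤1+h , i+j≡1+r = midpoint-split (s≤s⁻¹ r<1+2h)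
  in i , j , i<j , ≤-trans j≤1+h h<2^k ,
     subst (_ ∣ₛ_) (sym (qd-difference t b i j))
           (∣n⇒∣m*n (+ j - + i) (subst (λ e → + (1 + 2 * h) ∣ₛ (+ 2) ℤ.^ t ℤ.* + e ℤ.+ b) (sym i+j≡1+r) m∣root))
  where
  h<2^k : h < 2 ^ k
  h<2^k = *-cancelˡ-< 2 h (2 ^ k) (<-trans (n<1+n (2 * h)) m<2^[1+k])

double-collision : ∀ {t b k n} → Collision (suc t) b k n → Collision t b (suc k) (2 * n)
double-collision {t} {b} {n = n} (i , j , i<j , j≤2^k , n∣) =
  2 * i , 2 * j , *-monoʳ-< 2 i<j , *-monoʳ-≤ 2 j≤2^k ,
  subst₂ _∣ₛ_ (sym (pos-* 2 n)) (sym (qd-double-difference t b i j)) (*-monoʳ-∣ (+ 2) n∣)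

collision : ∀ t b k m → 0 < m → m < 2 ^ suc k → Collision t b k m
collision t b k m 0<m m<2^[1+k] with parity m
collision t b k       _ 0<m m<2^[1+k] | odd h        = odd-collision t b k h m<2^[1+k]
collision t b k       _ ()  m<2^[1+k] | even zero
collision t b zero    _ 0<m m<2^[1+k] | even (suc h) with *-cancelˡ-< 2 (suc h) 1 m<2^[1+k]
... | s≤s ()
collision t b (suc k) _ 0<m m<2^[1+k] | even (suc h) =
  double-collision {t} {b} {k} (collision (suc t) b k (suc h) (s≤s z≤n) (*-cancelˡ-< 2 (suc h) (2 ^ suc k) m<2^[1+k]))

lemma5 : (t : ℕ) → 0 < t → (b : ℤ) → OddInt b → (k : ℕ) → (m : ℕ) → 0 < m → m < 2 ^ (k + 1) → Σ ℕ (λ i → Σ ℕ (λ j → i < j × j ≤ 2 ^ k × (+ m) ∣ (qd t b j - qd t b i)))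
lemma5 t _ b _ k m 0<m m<2^[k+1] =
  let i , j , i<j , j≤2^k , m∣ = collision t b k m 0<m (subst (λ e → m < 2 ^ e) (+-comm k 1) m<2^[k+1])
  in i , j , i<j , j≤2^k , ∣⇒∣ᵤ m∣
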